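{- The system $\mathsf{DG}+\mathsf{PF\text{ - }TP}_{\exists}+\mathsf{QF\text{ - }AC}^{2,0}+\mathsf{MP}$ is inconsistent.
   Context: Work in the language of $\mathsf{E\text{ - }HA}^{\omega}$ (Heyting arithmetic in all finite types with the axiom of extensionality $(\mathsf{E})$, i.e. $(\forall \varphi^{\rho\to\tau})(\forall x^{\rho},y^{\rho})[x=_{\rho}y\to\varphi(x)=_{\tau}\varphi(y)]$ for all finite types, where equality at higher types is extensional, defined from $=_0$), extended with a predicate $\mathrm{st}^{\sigma}$ ("is standard") for every finite type $\sigma$. Write $(\forall^{\mathrm{st}}x)$, $(\exists^{\mathrm{st}}x)$ for quantifiers relativised to $\mathrm{st}$; a formula is internal if it does not involve $\mathrm{st}$. Strong majorizability $\leq^{*}$ is defined by: $x\leq_0^* y$ iff $x\leq_0 y$; $x\leq^*_{\rho\to\sigma}y$ iff $(\forall u)(\forall v\leq^*_{\rho}u)(xu\leq^*_{\sigma}yv\wedge yu\leq^*_{\sigma}yv)$. An object $x$ is monotone if $x\leq^* x$; $\tilde\forall$, $\tilde\exists$ range over monotone objects. The Dinis–Gaspar system $\mathsf{DG}$ is $\mathsf{E\text{ - }HA}^{\omega}$ plus: (a) $x=_\sigma y\to(\mathrm{st}(x)\to\mathrm{st}(y))$; (b) $\mathrm{st}^{\sigma}(y)\to(x\leq^*_{\sigma}y\to\mathrm{st}^{\sigma}(x))$; (c) $\mathrm{st}(t)$ for every closed term $t$; (d) $\mathrm{st}(z)\wedge\mathrm{st}(x)\to\mathrm{st}(zx)$;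 external induction $\Phi(0)\wedge(\forall^{\mathrm{st}}n^0)(\Phi(n)\to\Phi(n+1))\to(\forall^{\mathrm{st}}n^0)\Phi(n)$ for any $\Phi$; and the following schemes: monotone choice $(\tilde\forall^{\mathrm{st}}x)(\tilde\exists^{\mathrm{st}}y)\Phi(x,y)\to(\tilde\exists^{\mathrm{st}}f)(\tilde\forall^{\mathrm{st}}x)(\exists y\leq^* f(x))\Phi(x,y)$; realization $(\forall x)(\exists^{\mathrm{st}}y)\Phi(x,y)\to(\tilde\exists^{\mathrm{st}}z)(\forall x)(\exists y\leq^* z)\Phi(x,y)$ (any $\Phi$); idealisation $(\tilde\forall^{\mathrm{st}}z)(\exists x)(\forall y\leq^* z)\phi(x,y)\to(\exists x)(\forall^{\mathrm{st}}y)\phi(x,y)$ ($\phi$ internal); independence of premises $[(\tilde\forall^{\mathrm{st}}x)\phi(x)\to(\tilde\exists^{\mathrm{st}}y)\Psi(y)]\to(\tilde\exists^{\mathrm{st}}z)[(\tilde\forall^{\mathrm{st}}x)\phi(x)\to(\tilde\exists y\leq^* z)\Psi(y)]$ ($\phi$ internal); nonstandard Markov principle $[(\tilde\forall^{\mathrm{st}}x)\phi(x)\to\psi]\to(\tilde\exists^{\mathrm{st}}y)[(\forall x\leq^* y)\phi(x)\to\psi]$ ($\phi,\psi$ internal); majorizability $(\forall^{\mathrm{st}}x)(\exists^{\mathrm{st}}y)(x\leq^* y)$. $\mathsf{PF\text{ - }TP}_{\exists}$ (parameter-free Transfer): for every internal formula $\varphi(\underline{x})$ with all free variables shown (no parameters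 allowed), $(\exists\underline{x})\varphi(\underline{x})\to(\exists^{\mathrm{st}}\underline{x})\varphi(\underline{x})$. $\mathsf{QF\text{ - }AC}^{2,0}$: for quantifier-free $\varphi$, $(\forall Y^2)(\exists n^0)\varphi(Y,n)\to(\exists\Phi^{2\to0})(\forall Y^2)\varphi(Y,\Phi(Y))$. $\mathsf{MP}$ (Markov's principle): $(\forall f^1)[\neg\neg(\exists n)(f(n)=0)\to(\exists n)(f(n)=0)]$. -}

module Defs where

open import Data.List using (List; []; _∷_; map)
open import Data.List.Membership.Propositional using (_∈_)

infixr 7 _⇒_
data Ty : Set where
  𝟘   : Ty
  _⇒_ : Ty → Ty → Ty

ty1 : Ty
ty1 = 𝟘 ⇒ 𝟘

ty2 : Ty
ty2 = ty1 ⇒ 𝟘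

infixl 5 _,_
data Ctx : Set where
  ε   : Ctx
  _,_ : Ctx → Ty → Ctx

data Var : Ctx → Ty → Set where
  vz : ∀ {Γ σ} → Var (Γ , σ) σ
  vs : ∀ {Γ σ τ} → Var Γ σ → Var (Γ , τ) σ

_▸_ : Ctx → List Ty → Ctx
Γ ▸ []       = Γ
Γ ▸ (τ ∷ τs) = (Γ , τ) ▸ τs

infixl 9 _·_
data Tm (Γ : Ctx) : Ty → Set where
  var : ∀ {σ} → Var Γ σ → Tm Γ σ
  c0  : Tm Γ 𝟘
  cS  : Tm Γ (𝟘 ⇒ 𝟘)
  cΠ  : ∀ ρ σ → Tm Γ (ρ ⇒ σ ⇒ ρ)
  cΣ  : ∀ δ ρ τ → Tm Γ ((δ ⇒ ρ ⇒ τ) ⇒ (δ ⇒ ρ) ⇒ δ ⇒ τ)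
  cR  : ∀ ρ → Tm Γ (𝟘 ⇒ ρ ⇒ (ρ ⇒ 𝟘 ⇒ ρ) ⇒ ρ)
  _·_ : ∀ {σ τ} → Tm Γ (σ ⇒ τ) → Tm Γ σ → Tm Γ τ

infixr 4 _⊃_
infixr 5 _∨'_
infixr 6 _∧'_
infix 7 _≐₀_
data Fm (Γ : Ctx) : Set where
  ⊥'   : Fm Γ
  _≐₀_ : Tm Γ 𝟘 → Tm Γ 𝟘 → Fm Γ
  st   : ∀ σ → Tm Γ σ → Fm Γ
  _∧'_ : Fm Γ → Fm Γ → Fm Γ
  _∨'_ : Fm Γ → Fm Γ → Fm Γ
  _⊃_  : Fm Γ → Fm Γ → Fm Γ
  ∀'   : ∀ σ → Fm (Γ , σ) → Fm Γ
  ∃'   : ∀ σ → Fm (Γ , σ) → Fm Γ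

data Internal {Γ : Ctx} : Fm Γ → Set where
  i⊥ : Internal ⊥'
  i≐ : ∀ {s t} → Internal (s ≐₀ t)
  i∧ : ∀ {A B} → Internal A → Internal B → Internal (A ∧' B)
  i∨ : ∀ {A B} → Internal A → Internal B → Internal (A ∨' B)
  i⊃ : ∀ {A B} → Internal A → Internal B → Internal (A ⊃ B)
  i∀ : ∀ {σ A} → Internal {Γ , σ} A → Internal (∀' σ A)
  i∃ : ∀ {σ A} → Internal {Γ , σ} A → Internal (∃' σ A)

data QF {Γ : Ctx} : Fm Γ → Set where
  q⊥ : QF ⊥'
  q≐ : ∀ {s t} → QF (s ≐₀ t)
  q∧ : ∀ {A B} → QF A → QF B → QF (A ∧' B)
  q∨ : ∀ {A B} → QF A → QF B → QF (A ∨' B)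
  q⊃ : ∀ {A B} → QF A → QF B → QF (A ⊃ B)

Ren : Ctx → Ctx → Set
Ren Γ Δ = ∀ {σ} → Var Γ σ → Var Δ σ

liftR : ∀ {Γ Δ τ} → Ren Γ Δ → Ren (Γ , τ) (Δ , τ)
liftR r vz     = vz
liftR r (vs x) = vs (r x)

renT : ∀ {Γ Δ σ} → Ren Γ Δ → Tm Γ σ → Tm Δ σ
renT r (var x)    = var (r x)
renT r c0         = c0
renT r cS         = cS
renT r (cΠ ρ σ)   = cΠ ρ σ
renT r (cΣ δ ρ τ) = cΣ δ ρ τ
renT r (cR ρ)     = cR ρ
renT r (f · a)    = renT r f · renT r a

renF : ∀ {Γ Δ} → Ren Γ Δ → Fm Γ → Fm Δ
renF r ⊥'        = ⊥'
renF r (s ≐₀ t)  = renT r s ≐₀ renT r t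
renF r (st σ t)  = st σ (renT r t)
renF r (A ∧' B)  = renF r A ∧' renF r B
renF r (A ∨' B)  = renF r A ∨' renF r B
renF r (A ⊃ B)   = renF r A ⊃ renF r B
renF r (∀' σ A)  = ∀' σ (renF (liftR r) A)
renF r (∃' σ A)  = ∃' σ (renF (liftR r) A)

Sub : Ctx → Ctx → Set
Sub Γ Δ = ∀ {σ} → Var Γ σ → Tm Δ σ

liftS : ∀ {Γ Δ τ} → Sub Γ Δ → Sub (Γ , τ) (Δ , τ)
liftS s vz     = var vz
liftS s (vs x) = renT vs (s x)

subT : ∀ {Γ Δ σ} → Sub Γ Δ → Tm Γ σ → Tm Δ σ
subT s (var x)    = s x
subT s c0         = c0
subT s cS         = cS
subT s (cΠ ρ σ)   = cΠ ρ σ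
subT s (cΣ δ ρ τ) = cΣ δ ρ τ
subT s (cR ρ)     = cR ρ
subT s (f · a)    = subT s f · subT s a

subF : ∀ {Γ Δ} → Sub Γ Δ → Fm Γ → Fm Δ
subF s ⊥'        = ⊥'
subF s (a ≐₀ b)  = subT s a ≐₀ subT s b
subF s (st σ t)  = st σ (subT s t)
subF s (A ∧' B)  = subF s A ∧' subF s B
subF s (A ∨' B)  = subF s A ∨' subF s B
subF s (A ⊃ B)   = subF s A ⊃ subF s B
subF s (∀' σ A)  = ∀' σ (subF (liftS s) A)
subF s (∃' σ A)  = ∃' σ (subF (liftS s) A)

single : ∀ {Γ σ} → Tm Γ σ → Sub (Γ , σ) Γ
single t vz     = t
single t (vs x) = var x

_[_] : ∀ {Γ σ} → Fm (Γ , σ) → Tm Γ σ → Fm Γ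
A [ t ] = subF (single t) A

wkT : ∀ {Γ σ τ} → Tm Γ σ → Tm (Γ , τ) σ
wkT = renT vs

wkF : ∀ {Γ τ} → Fm Γ → Fm (Γ , τ)
wkF = renF vs

closedR : ∀ {Γ} → Ren ε Γ
closedR ()

wk₂ : ∀ {Γ ρ σ τ} → Fm (Γ , σ , τ) → Fm (Γ , ρ , σ , τ)
wk₂ = renF (liftR (liftR vs))

wk₁ : ∀ {Γ ρ σ} → Fm (Γ , σ) → Fm (Γ , ρ , σ)
wk₁ = renF (liftR vs)

v0 : ∀ {Γ σ} → Tm (Γ , σ) σ
v0 = var vz

v1 : ∀ {Γ σ τ} → Tm (Γ , σ , τ) σ
v1 = var (vs vz)

v2 : ∀ {Γ σ τ ρ} → Tm (Γ , σ , τ , ρ) σ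
v2 = var (vs (vs vz))

-- Bracket abstraction (λ-abstraction definable from Π and Σ)

lam : ∀ {Γ σ τ} → Tm (Γ , σ) τ → Tm Γ (σ ⇒ τ)
lam {σ = σ} (var vz)     = cΣ σ (σ ⇒ σ) σ · cΠ σ (σ ⇒ σ) · cΠ σ σ
lam {σ = σ} (var (vs x)) = cΠ _ σ · var x
lam {σ = σ} c0           = cΠ _ σ · c0
lam {σ = σ} cS           = cΠ _ σ · cS
lam {σ = σ} (cΠ ρ τ)     = cΠ _ σ · cΠ ρ τ
lam {σ = σ} (cΣ δ ρ τ)   = cΠ _ σ · cΣ δ ρ τ
lam {σ = σ} (cR ρ)       = cΠ _ σ · cR ρ
lam {σ = σ} (_·_ {ρ} {τ} f a) = cΣ σ ρ τ · lam f · lam a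

predT : ∀ {Γ} → Tm Γ 𝟘 → Tm Γ 𝟘
predT n = cR 𝟘 · n · c0 · lam (lam v0)

monus : ∀ {Γ} → Tm Γ 𝟘 → Tm Γ 𝟘 → Tm Γ 𝟘
monus x y = cR 𝟘 · y · x · lam (lam (predT v1))

_≤₀_ : ∀ {Γ} → Tm Γ 𝟘 → Tm Γ 𝟘 → Fm Γ
x ≤₀ y = monus x y ≐₀ c0

¬' : ∀ {Γ} → Fm Γ → Fm Γ
¬' A = A ⊃ ⊥'

eq : ∀ {Γ} σ → Tm Γ σ → Tm Γ σ → Fm Γ
eq 𝟘       x y = x ≐₀ y
eq (ρ ⇒ τ) x y = ∀' ρ (eq τ (wkT x · v0) (wkT y · v0))

-- strong majorizability x ≤*_σ y (Howard/Bezem):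
-- x ≤*_{ρ→τ} y  iff  ∀u ∀v (v ≤*_ρ u → x v ≤*_τ y u ∧ y v ≤*_τ y u)
maj : ∀ {Γ} σ → Tm Γ σ → Tm Γ σ → Fm Γ
maj 𝟘       x y = x ≤₀ y
maj (ρ ⇒ τ) x y =
  ∀' ρ (∀' ρ (maj ρ v0 v1 ⊃
     (maj τ (wkT (wkT x) · v0) (wkT (wkT y) · v1)
      ∧' maj τ (wkT (wkT y) · v0) (wkT (wkT y) · v1))))

mono : ∀ {Γ} σ → Tm Γ σ → Fm Γ
mono σ x = maj σ x x

∀st ∃st ∀~st ∃~st : ∀ {Γ} σ → Fm (Γ , σ) → Fm Γ
∀st σ A  = ∀' σ (st σ v0 ⊃ A)
∃st σ A  = ∃' σ (st σ v0 ∧' A)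
∀~st σ A = ∀' σ ((st σ v0 ∧' mono σ v0) ⊃ A)
∃~st σ A = ∃' σ (st σ v0 ∧' mono σ v0 ∧' A)

∀≤ ∃≤ ∃~≤ : ∀ {Γ} σ → Tm Γ σ → Fm (Γ , σ) → Fm Γ
∀≤ σ z A  = ∀' σ (maj σ v0 (wkT z) ⊃ A)
∃≤ σ z A  = ∃' σ (maj σ v0 (wkT z) ∧' A)
∃~≤ σ z A = ∃' σ (mono σ v0 ∧' maj σ v0 (wkT z) ∧' A)

∃s : ∀ {Γ} τs → Fm (Γ ▸ τs) → Fm Γ
∃s []       A = A
∃s (τ ∷ τs) A = ∃' τ (∃s τs A)

∃sts : ∀ {Γ} τs → Fm (Γ ▸ τs) → Fm Γ
∃sts []       A = A
∃sts (τ ∷ τs) A = ∃st τ (∃sts τs A)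

sucS : ∀ {Γ} → Sub (Γ , 𝟘) (Γ , 𝟘)
sucS vz     = cS · var vz
sucS (vs x) = var (vs x)

-- φ(Y, n) ↦ φ(Y, Φ(Y)) moved to context Γ,Φ,Y
acS : ∀ {Γ} → Sub (Γ , ty2 , 𝟘) (Γ , (ty2 ⇒ 𝟘) , ty2)
acS vz          = var (vs vz) · var vz
acS (vs vz)     = var vz
acS (vs (vs x)) = var (vs (vs x))

-- Axioms of DG + PF-TP_∃ + QF-AC^{2,0} + MP (instances in context Γ;
-- schemes may contain parameters from Γ unless stated otherwise)

data Axiom (Γ : Ctx) : Fm Γ → Set where
  ax-refl  : (t : Tm Γ 𝟘) → Axiom Γ (t ≐₀ t)
  ax-leib  : (A : Fm (Γ , 𝟘)) → Internal A → (s t : Tm Γ 𝟘) →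
             Axiom Γ (s ≐₀ t ⊃ A [ s ] ⊃ A [ t ])
  ax-S≢0   : (t : Tm Γ 𝟘) → Axiom Γ (¬' (cS · t ≐₀ c0))
  ax-Sinj  : (s t : Tm Γ 𝟘) → Axiom Γ (cS · s ≐₀ cS · t ⊃ s ≐₀ t)
  ax-Π     : ∀ ρ σ (x : Tm Γ ρ) (y : Tm Γ σ) → Axiom Γ (eq ρ (cΠ ρ σ · x · y) x)
  ax-Σ     : ∀ δ ρ τ (x : Tm Γ (δ ⇒ ρ ⇒ τ)) (y : Tm Γ (δ ⇒ ρ)) (z : Tm Γ δ) →
             Axiom Γ (eq τ (cΣ δ ρ τ · x · y · z) (x · z · (y · z)))
  ax-R0    : ∀ ρ (y : Tm Γ ρ) (z : Tm Γ (ρ ⇒ 𝟘 ⇒ ρ)) →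
             Axiom Γ (eq ρ (cR ρ · c0 · y · z) y)
  ax-RS    : ∀ ρ (n : Tm Γ 𝟘) (y : Tm Γ ρ) (z : Tm Γ (ρ ⇒ 𝟘 ⇒ ρ)) →
             Axiom Γ (eq ρ (cR ρ · (cS · n) · y · z) (z · (cR ρ · n · y · z) · n))
  ax-ind   : (A : Fm (Γ , 𝟘)) → Internal A →
             Axiom Γ ((A [ c0 ] ∧' ∀' 𝟘 (A ⊃ subF sucS A)) ⊃ ∀' 𝟘 A)
  ax-ext   : ∀ ρ τ → Axiom Γ (∀' (ρ ⇒ τ) (∀' ρ (∀' ρ
               (eq ρ v1 v0 ⊃ eq τ (v2 · v1) (v2 · v0)))))
  ax-st-eq   : ∀ σ → Axiom Γ (∀' σ (∀' σ (eq σ v1 v0 ⊃ st σ v1 ⊃ st σ v0)))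
  ax-st-maj  : ∀ σ → Axiom Γ (∀' σ (∀' σ (st σ v1 ⊃ maj σ v0 v1 ⊃ st σ v0)))
  ax-st-cl   : ∀ σ (t : Tm ε σ) → Axiom Γ (st σ (renT closedR t))
  ax-st-app  : ∀ σ τ → Axiom Γ (∀' (σ ⇒ τ) (∀' σ
                 ((st (σ ⇒ τ) v1 ∧' st σ v0) ⊃ st τ (v1 · v0))))
  ax-extind  : (Φ : Fm (Γ , 𝟘)) →
               Axiom Γ ((Φ [ c0 ] ∧' ∀st 𝟘 (Φ ⊃ subF sucS Φ)) ⊃ ∀st 𝟘 Φ)
  ax-mAC     : ∀ σ τ (Φ : Fm (Γ , σ , τ)) →
               Axiom Γ (∀~st σ (∃~st τ Φ) ⊃
                        ∃~st (σ ⇒ τ) (∀~st σ (∃≤ τ (v1 · v0) (wk₂ Φ))))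
  ax-R       : ∀ σ τ (Φ : Fm (Γ , σ , τ)) →
               Axiom Γ (∀' σ (∃st τ Φ) ⊃
                        ∃~st τ (∀' σ (∃≤ τ v1 (wk₂ Φ))))
  ax-I       : ∀ σ τ (φ : Fm (Γ , σ , τ)) → Internal φ →
               Axiom Γ (∀~st τ (∃' σ (∀≤ τ v1 (wk₂ φ))) ⊃ ∃' σ (∀st τ φ))
  ax-IP      : ∀ σ τ (φ : Fm (Γ , σ)) → Internal φ → (Ψ : Fm (Γ , τ)) →
               Axiom Γ ((∀~st σ φ ⊃ ∃~st τ Ψ) ⊃
                        ∃~st τ (∀~st σ (wk₁ φ) ⊃ ∃~≤ τ v0 (wk₁ Ψ)))
  ax-NMP     : ∀ σ (φ : Fm (Γ , σ)) → Internal φ → (ψ : Fm Γ) → Internal ψ →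
               Axiom Γ ((∀~st σ φ ⊃ ψ) ⊃
                        ∃~st σ (∀≤ σ v0 (wk₁ φ) ⊃ wkF ψ))
  ax-maj     : ∀ σ → Axiom Γ (∀st σ (∃st σ (maj σ v1 v0)))
  ax-PFTP    : ∀ τs (φ : Fm (ε ▸ τs)) → Internal φ →
               Axiom Γ (renF closedR (∃s τs φ ⊃ ∃sts τs φ))
  ax-QFAC    : (φ : Fm (Γ , ty2 , 𝟘)) → QF φ →
               Axiom Γ (∀' ty2 (∃' 𝟘 φ) ⊃
                        ∃' (ty2 ⇒ 𝟘) (∀' ty2 (subF acS φ)))
  ax-MP      : Axiom Γ (∀' ty1 (¬' (¬' (∃' 𝟘 (v1 · v0 ≐₀ c0))) ⊃
                                 ∃' 𝟘 (v1 · v0 ≐₀ c0)))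

data Der : (Γ : Ctx) → List (Fm Γ) → Fm Γ → Set where
  hyp   : ∀ {Γ Δ A} → A ∈ Δ → Der Γ Δ A
  axiom : ∀ {Γ Δ A} → Axiom Γ A → Der Γ Δ A
  ⊥E    : ∀ {Γ Δ A} → Der Γ Δ ⊥' → Der Γ Δ A
  ∧I    : ∀ {Γ Δ A B} → Der Γ Δ A → Der Γ Δ B → Der Γ Δ (A ∧' B)
  ∧E₁   : ∀ {Γ Δ A B} → Der Γ Δ (A ∧' B) → Der Γ Δ A
  ∧E₂   : ∀ {Γ Δ A B} → Der Γ Δ (A ∧' B) → Der Γ Δ B
  ∨I₁   : ∀ {Γ Δ A B} → Der Γ Δ A → Der Γ Δ (A ∨' B)
  ∨I₂   : ∀ {Γ Δ A B} → Der Γ Δ B → Der Γ Δ (A ∨' B)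
  ∨E    : ∀ {Γ Δ A B C} → Der Γ Δ (A ∨' B) →
          Der Γ (A ∷ Δ) C → Der Γ (B ∷ Δ) C → Der Γ Δ C
  ⊃I    : ∀ {Γ Δ A B} → Der Γ (A ∷ Δ) B → Der Γ Δ (A ⊃ B)
  ⊃E    : ∀ {Γ Δ A B} → Der Γ Δ (A ⊃ B) → Der Γ Δ A → Der Γ Δ B
  ∀I    : ∀ {Γ Δ σ A} → Der (Γ , σ) (map wkF Δ) A → Der Γ Δ (∀' σ A)
  ∀E    : ∀ {Γ Δ σ A} → Der Γ Δ (∀' σ A) → (t : Tm Γ σ) → Der Γ Δ (A [ t ])
  ∃I    : ∀ {Γ Δ σ A} → (t : Tm Γ σ) → Der Γ Δ (A [ t ]) → Der Γ Δ (∃' σ A)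
  ∃E    : ∀ {Γ Δ σ A C} → Der Γ Δ (∃' σ A) →
          Der (Γ , σ) (A ∷ map wkF Δ) (wkF C) → Der Γ Δ C

Inconsistent : Set
Inconsistent = Der ε [] ⊥'

-- Idealisation yields a nonstandard number N. For Y of type 2 let probe Y n = Y(λm. m ∸ n)
-- and gap Y = Y(λm. 0) ∸ Y(probe Y); then test Y n = 0 holds iff probe Y n ≠ 0 or gap Y = 0.
-- Some n solves test Y n = 0 up to double negation: if probe Y vanished everywhere it would
-- equal λm. 0 extensionally, and then gap Y = 0. Markov's principle removes the double
-- negation, QF-AC^{2,0} yields a selector Φ, and PF-TP_∃ makes Φ standard because "Φ is a
-- selector" has no parameters. The functional isZeroAt N = λα. 1 ∸ α(N) is majorised by the
-- closed term λα. 1, hence standard, and so is Φ(isZeroAt N). But probe (isZeroAt N) n is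
-- 1 ∸ (N ∸ n), which vanishes for n < N, while gap (isZeroAt N) = 1; so N ≤ Φ(isZeroAt N)
-- and N would be standard.

module Submission where

open import Defs
open import Data.List using (List; []; _∷_)
open import Data.List.Relation.Unary.Any using (here; there)
open import Data.Nat using (ℕ; zero; suc)
open import Data.Maybe using (Maybe; just; nothing)
open import Data.Product using (Σ; proj₁; proj₂) renaming (_,_ to _&_)
open import Relation.Binary.PropositionalEquality using (_≡_; refl; sym; trans; cong; cong₂; subst)

subT-id : ∀ {Γ σ} (t : Tm Γ σ) → subT var t ≡ t
subT-id (var x)    = refl
subT-id c0         = refl
subT-id cS         = refl
subT-id (cΠ ρ σ)   = refl
subT-id (cΣ δ ρ τ) = refl
subT-id (cR ρ)     = refl
subT-id (f · a)    = cong₂ _·_ (subT-id f) (subT-id a)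

subT-renT : ∀ {Γ Δ Θ σ} (s : Sub Δ Θ) (r : Ren Γ Δ) (t : Tm Γ σ) →
            subT s (renT r t) ≡ subT (λ x → s (r x)) t
subT-renT s r (var x)    = refl
subT-renT s r c0         = refl
subT-renT s r cS         = refl
subT-renT s r (cΠ ρ σ)   = refl
subT-renT s r (cΣ δ ρ τ) = refl
subT-renT s r (cR ρ)     = refl
subT-renT s r (f · a)    = cong₂ _·_ (subT-renT s r f) (subT-renT s r a)

renT-subT : ∀ {Γ Δ Θ σ} (r : Ren Δ Θ) (s : Sub Γ Δ) (t : Tm Γ σ) →
            renT r (subT s t) ≡ subT (λ x → renT r (s x)) t
renT-subT r s (var x)    = refl
renT-subT r s c0         = refl
renT-subT r s cS         = refl
renT-subT r s (cΠ ρ σ)   = refl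
renT-subT r s (cΣ δ ρ τ) = refl
renT-subT r s (cR ρ)     = refl
renT-subT r s (f · a)    = cong₂ _·_ (renT-subT r s f) (renT-subT r s a)

subT-single-wkT : ∀ {Γ σ τ} (u : Tm Γ τ) (t : Tm Γ σ) → subT (single u) (wkT t) ≡ t
subT-single-wkT u t = trans (subT-renT (single u) vs t) (subT-id t)

subT-liftS-wkT : ∀ {Γ Δ σ τ} (s : Sub Γ Δ) (t : Tm Γ σ) →
                 subT (liftS {τ = τ} s) (wkT t) ≡ wkT (subT s t)
subT-liftS-wkT s t = trans (subT-renT (liftS s) vs t) (sym (renT-subT vs s t))

subF-eq : ∀ {Γ Δ} (s : Sub Γ Δ) σ (x y : Tm Γ σ) →
          subF s (eq σ x y) ≡ eq σ (subT s x) (subT s y)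
subF-eq s 𝟘       x y = refl
subF-eq s (ρ ⇒ τ) x y = cong (∀' ρ) (trans (subF-eq (liftS s) τ _ _)
  (cong₂ (λ a b → eq τ (a · v0) (b · v0)) (subT-liftS-wkT s x) (subT-liftS-wkT s y)))

subF-maj : ∀ {Γ Δ} (s : Sub Γ Δ) σ (x y : Tm Γ σ) →
           subF s (maj σ x y) ≡ maj σ (subT s x) (subT s y)
subF-maj s 𝟘       x y = refl
subF-maj {Γ} {Δ} s (ρ ⇒ τ) x y = cong (λ A → ∀' ρ (∀' ρ A)) (cong₂ _⊃_ (subF-maj s₂ ρ v0 v1)
  (cong₂ _∧'_ (trans (subF-maj s₂ τ _ _) (cong₂ (λ a b → maj τ (a · v0) (b · v1)) (lift₂ x) (lift₂ y)))
              (trans (subF-maj s₂ τ _ _) (cong₂ (λ a b → maj τ (a · v0) (b · v1)) (lift₂ y) (lift₂ y)))))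
  where
  s₂ : Sub (Γ , ρ , ρ) (Δ , ρ , ρ)
  s₂ = liftS (liftS s)
  lift₂ : (t : Tm Γ (ρ ⇒ τ)) → subT s₂ (wkT (wkT t)) ≡ wkT (wkT (subT s t))
  lift₂ t = trans (subT-liftS-wkT (liftS s) (wkT t)) (cong wkT (subT-liftS-wkT s t))

module _ {Γ : Ctx} {Δ : List (Fm Γ)} where

  ≐-refl : (t : Tm Γ 𝟘) → Der Γ Δ (t ≐₀ t)
  ≐-refl t = axiom (ax-refl t)

  ≐-subst : (C D : Tm (Γ , 𝟘) 𝟘) {s t : Tm Γ 𝟘} → Der Γ Δ (s ≐₀ t) →
            Der Γ Δ (subT (single s) C ≐₀ subT (single s) D) →
            Der Γ Δ (subT (single t) C ≐₀ subT (single t) D)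
  ≐-subst C D {s} {t} s≐t = ⊃E (⊃E (axiom (ax-leib (C ≐₀ D) i≐ s t)) s≐t)

  ≐-sym : {s t : Tm Γ 𝟘} → Der Γ Δ (s ≐₀ t) → Der Γ Δ (t ≐₀ s)
  ≐-sym {s} {t} s≐t = subst (λ u → Der Γ Δ (t ≐₀ u)) (subT-single-wkT t s)
    (≐-subst v0 (wkT s) s≐t (subst (λ u → Der Γ Δ (s ≐₀ u)) (sym (subT-single-wkT s s)) (≐-refl s)))

  ≐-trans : {s t u : Tm Γ 𝟘} → Der Γ Δ (s ≐₀ t) → Der Γ Δ (t ≐₀ u) → Der Γ Δ (s ≐₀ u)
  ≐-trans {s} {t} {u} s≐t t≐u = subst (λ w → Der Γ Δ (w ≐₀ u)) (subT-single-wkT u s)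
    (≐-subst (wkT s) v0 t≐u (subst (λ w → Der Γ Δ (w ≐₀ t)) (sym (subT-single-wkT t s)) s≐t))

  ≐-cong : (C : Tm (Γ , 𝟘) 𝟘) {s t : Tm Γ 𝟘} → Der Γ Δ (s ≐₀ t) →
           Der Γ Δ (subT (single s) C ≐₀ subT (single t) C)
  ≐-cong C {s} {t} s≐t = subst (λ w → Der Γ Δ (w ≐₀ subT (single t) C)) (subT-single-wkT t _)
    (≐-subst (wkT (subT (single s) C)) C s≐t
      (subst (λ w → Der Γ Δ (w ≐₀ subT (single s) C)) (sym (subT-single-wkT s _)) (≐-refl _)))

  eq-app : ∀ {α β} {f g : Tm Γ (α ⇒ β)} → Der Γ Δ (eq (α ⇒ β) f g) → (a : Tm Γ α) →
           Der Γ Δ (eq β (f · a) (g · a))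
  eq-app {β = β} {f} {g} f≈g a = subst (Der Γ Δ)
    (trans (subF-eq (single a) β _ _)
           (cong₂ (λ p q → eq β (p · a) (q · a)) (subT-single-wkT a f) (subT-single-wkT a g)))
    (∀E f≈g a)

  eq-cong : ∀ {α β} (f : Tm Γ (α ⇒ β)) {a b : Tm Γ α} → Der Γ Δ (eq α a b) →
            Der Γ Δ (eq β (f · a) (f · b))
  eq-cong {α} {β} f {a} {b} = ⊃E (subst (Der Γ Δ) instance-of-ext
    (∀E (∀E (∀E (axiom (ax-ext α β)) f) a) b))
    where
    s₁ : Sub (Γ , (α ⇒ β) , α , α) (Γ , α , α)
    s₁ = liftS (liftS (single f))
    s₂ : Sub (Γ , α , α) (Γ , α)
    s₂ = liftS (single a)
    s₃ : Sub (Γ , α) Γ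
    s₃ = single b
    subF-eq₃ : ∀ κ (x y : Tm (Γ , (α ⇒ β) , α , α) κ) →
               subF s₃ (subF s₂ (subF s₁ (eq κ x y))) ≡
               eq κ (subT s₃ (subT s₂ (subT s₁ x))) (subT s₃ (subT s₂ (subT s₁ y)))
    subF-eq₃ κ x y = trans (cong (subF s₃) (trans (cong (subF s₂) (subF-eq s₁ κ x y)) (subF-eq s₂ κ _ _)))
                           (subF-eq s₃ κ _ _)
    a-inst : subT s₃ (wkT a) ≡ a
    a-inst = subT-single-wkT b a
    f-inst : subT s₃ (subT s₂ (wkT (wkT f))) ≡ f
    f-inst = trans (cong (subT s₃) (trans (subT-liftS-wkT (single a) (wkT f)) (cong wkT (subT-single-wkT a f))))
                   (subT-single-wkT b f)
    instance-of-ext : subF s₃ (subF s₂ (subF s₁ (eq α v1 v0 ⊃ eq β (v2 · v1) (v2 · v0)))) ≡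
                      (eq α a b ⊃ eq β (f · a) (f · b))
    instance-of-ext = cong₂ _⊃_
      (trans (subF-eq₃ α v1 v0) (cong (λ u → eq α u b) a-inst))
      (trans (subF-eq₃ β _ _) (cong₂ (λ g u → eq β (g · u) (g · b)) f-inst a-inst))

  st-app : ∀ {σ τ} {f : Tm Γ (σ ⇒ τ)} {a : Tm Γ σ} →
           Der Γ Δ (st (σ ⇒ τ) f) → Der Γ Δ (st σ a) → Der Γ Δ (st τ (f · a))
  st-app {σ} {τ} {f} {a} st-f st-a =
    subst (λ g → Der Γ Δ (st τ (g · a))) (subT-single-wkT a f)
      (⊃E (∀E (∀E (axiom (ax-st-app σ τ)) f) a)
          (∧I (subst (λ g → Der Γ Δ (st (σ ⇒ τ) g)) (sym (subT-single-wkT a f)) st-f) st-a))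

  st-majorised : ∀ σ {s t : Tm Γ σ} → Der Γ Δ (st σ t) → Der Γ Δ (maj σ s t) → Der Γ Δ (st σ s)
  st-majorised σ {s} {t} st-t s≤*t =
    ⊃E (⊃E (∀E (∀E (axiom (ax-st-maj σ)) t) s)
           (subst (λ u → Der Γ Δ (st σ u)) (sym (subT-single-wkT s t)) st-t))
       (subst (Der Γ Δ) (sym instance-of-maj) s≤*t)
    where
    instance-of-maj : subF (single s) (subF (liftS (single t)) (maj σ v0 v1)) ≡ maj σ s t
    instance-of-maj = trans (cong (subF (single s)) (subF-maj (liftS (single t)) σ v0 v1))
      (trans (subF-maj (single s) σ v0 (wkT t)) (cong (maj σ s) (subT-single-wkT s t)))

Conv : ∀ Γ σ → Tm Γ σ → Tm Γ σ → Set
Conv Γ σ t u = ∀ {Δ} → Der Γ Δ (eq σ t u)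

step : ∀ {Γ σ} (t : Tm Γ σ) → Maybe (Σ (Tm Γ σ) (Conv Γ σ t))
step (cΠ ρ σ · x · y)          = just (x & axiom (ax-Π ρ σ x y))
step (cΣ δ ρ τ · x · y · z)    = just (_ & axiom (ax-Σ δ ρ τ x y z))
step (cR ρ · c0 · y · z)       = just (y & axiom (ax-R0 ρ y z))
step (cR ρ · (cS · n) · y · z) = just (_ & axiom (ax-RS ρ n y z))
step (f · a) with step f
... | just (f' & f≈f') = just (f' · a & eq-app f≈f' a)
... | nothing with step a
...   | just (a' & a≈a') = just (f · a' & eq-cong f a≈a')
...   | nothing = nothing
step _ = nothing

normalise-in : ∀ {Γ} → ℕ → (t : Tm Γ 𝟘) → Σ (Tm Γ 𝟘) (Conv Γ 𝟘 t)
normalise-in zero    t = t & ≐-refl t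
normalise-in (suc n) t with step t
... | nothing = t & ≐-refl t
... | just (t' & t≐t') with normalise-in n t'
...   | (u & t'≐u) = u & ≐-trans t≐t' t'≐u

-- The step bound only limits which equations ≐-by-normalising can certify.
normalise-with-proof : ∀ {Γ} (t : Tm Γ 𝟘) → Σ (Tm Γ 𝟘) (Conv Γ 𝟘 t)
normalise-with-proof = normalise-in 30000

normalise : ∀ {Γ} → Tm Γ 𝟘 → Tm Γ 𝟘
normalise t = proj₁ (normalise-with-proof t)

module _ {Γ : Ctx} {Δ : List (Fm Γ)} where

  ≐-by-normalising : {a b : Tm Γ 𝟘} → normalise a ≡ normalise b → Der Γ Δ (a ≐₀ b)
  ≐-by-normalising {a} {b} same = ≐-trans (proj₂ (normalise-with-proof a))
    (subst (λ u → Der Γ Δ (u ≐₀ b)) (sym same) (≐-sym (proj₂ (normalise-with-proof b))))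

  ≐-normalise-cong : (C : Tm (Γ , 𝟘) 𝟘) {s t a : Tm Γ 𝟘} → Der Γ Δ (s ≐₀ t) →
                     normalise a ≡ normalise (subT (single s) C) → Der Γ Δ (a ≐₀ subT (single t) C)
  ≐-normalise-cong C s≐t same = ≐-trans (≐-by-normalising same) (≐-cong C s≐t)

one : ∀ {Γ} → Tm Γ 𝟘
one = cS · c0

private variable
  Γ : Ctx
  Δ : List (Fm Γ)

zero-or-suc : Der Γ Δ (∀' 𝟘 (v0 ≐₀ c0 ∨' ∃' 𝟘 (v1 ≐₀ cS · v0)))
zero-or-suc = ⊃E (axiom (ax-ind _ (i∨ i≐ (i∃ i≐))))
  (∧I (∨I₁ (≐-refl c0)) (∀I (⊃I (∨I₂ (∃I v0 (≐-refl _))))))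

monus-suc-suc : Der Γ Δ (∀' 𝟘 (∀' 𝟘 (monus (cS · v0) (cS · v1) ≐₀ monus v0 v1)))
monus-suc-suc = ⊃E (axiom (ax-ind _ (i∀ i≐)))
  (∧I (∀I (≐-by-normalising refl))
      (∀I (⊃I (∀I (≐-trans (≐-normalise-cong (predT v0) (∀E (hyp (here refl)) v0) refl)
                           (≐-by-normalising refl))))))

monus-self : Der Γ Δ (∀' 𝟘 (monus v0 v0 ≐₀ c0))
monus-self = ⊃E (axiom (ax-ind _ i≐))
  (∧I (≐-by-normalising refl) (∀I (⊃I (≐-trans (∀E (∀E monus-suc-suc v0) v0) (hyp (here refl))))))

one-monus-suc : Der Γ Δ (∀' 𝟘 (monus one (cS · v0) ≐₀ c0))
one-monus-suc = ⊃E (axiom (ax-ind _ i≐))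
  (∧I (≐-by-normalising refl)
      (∀I (⊃I (≐-trans (≐-normalise-cong (predT v0) (hyp (here refl)) refl) (≐-by-normalising refl)))))

suc-monus-self : Der Γ Δ (∀' 𝟘 (monus (cS · v0) v0 ≐₀ one))
suc-monus-self = ⊃E (axiom (ax-ind _ i≐))
  (∧I (≐-by-normalising refl) (∀I (⊃I (≐-trans (∀E (∀E monus-suc-suc v0) (cS · v0)) (hyp (here refl))))))

one-monus-≤₀-one : Der Γ Δ (∀' 𝟘 (monus one v0 ≤₀ one))
one-monus-≤₀-one = ∀I (∨E (∀E zero-or-suc v0)
  (≐-trans (≐-normalise-cong (monus (monus one v0) one) (hyp (here refl)) refl) (≐-by-normalising refl))
  (∃E (hyp (here refl))
    (≐-trans (≐-normalise-cong (monus (monus one v0) one) (hyp (here refl)) refl)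
      (≐-trans (≐-normalise-cong (monus v0 one) (∀E one-monus-suc v0) refl) (≐-by-normalising refl)))))

≤₀⇒suc≢ : Der Γ Δ (∀' 𝟘 (∀' 𝟘 (v0 ≤₀ v1 ⊃ ¬' (cS · v1 ≐₀ v0))))
≤₀⇒suc≢ = ∀I (∀I (⊃I (⊃I (⊃E (axiom (ax-S≢0 c0))
  (≐-trans (≐-sym (∀E suc-monus-self v1))
    (≐-trans (≐-cong (monus v0 v2) (hyp (here refl))) (hyp (there (here refl)))))))))

v3 : ∀ {σ τ ρ κ} → Tm (Γ , σ , τ , ρ , κ) σ
v3 = var (vs (vs (vs vz)))

zeroFn : Tm Γ ty1
zeroFn = lam c0

probe : Tm Γ ty2 → Tm Γ ty1
probe Y = lam (wkT Y · lam (monus v0 v1))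

gap : Tm Γ ty2 → Tm Γ 𝟘
gap Y = monus (Y · zeroFn) (Y · probe Y)

zeroStep : Tm Γ (𝟘 ⇒ 𝟘 ⇒ 𝟘)
zeroStep = lam (lam c0)

test : Tm Γ (ty2 ⇒ ty1)
test = lam (lam (cR 𝟘 · (probe v1 · v0) · gap v1 · zeroStep))

isSelector : Fm (Γ , (ty2 ⇒ 𝟘))
isSelector = ∀' ty2 (test · v0 · (v1 · v0) ≐₀ c0)

test-not-not-solvable : Der (Γ , ty2) Δ (¬' (¬' (∃' 𝟘 (test · v1 · v0 ≐₀ c0))))
test-not-not-solvable {Γ} {Δ} = ⊃I (⊃E (hyp (here refl)) (∃I c0 solved-at-zero))
  where
  Θ : List (Fm (Γ , ty2))
  Θ = ¬' (∃' 𝟘 (test · v1 · v0 ≐₀ c0)) ∷ Δ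
  probe-vanishes : Der (Γ , ty2) Θ (eq ty1 zeroFn (probe v0))
  probe-vanishes = ∀I (≐-trans (≐-by-normalising refl) (≐-sym
    (∨E (∀E zero-or-suc (probe v1 · v0)) (hyp (here refl))
      (∃E (hyp (here refl)) (⊥E (⊃E (hyp (there (there (here refl)))) (∃I v1
        (≐-trans (≐-normalise-cong (cR 𝟘 · v0 · gap v3 · zeroStep) (hyp (here refl)) refl)
                 (≐-by-normalising refl)))))))))
  gap-vanishes : Der (Γ , ty2) Θ (gap v0 ≐₀ c0)
  gap-vanishes = ≐-trans (≐-cong (monus v0 (v1 · probe v1)) (eq-cong v0 probe-vanishes))
                         (∀E monus-self (v0 · probe v0))
  solved-at-zero : Der (Γ , ty2) Θ (test · v0 · c0 ≐₀ c0)
  solved-at-zero = ≐-trans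
    (≐-normalise-cong (cR 𝟘 · v0 · gap v1 · zeroStep) (≐-sym (∀E probe-vanishes c0)) refl)
    (≐-trans (≐-by-normalising refl) gap-vanishes)

isZeroAt : Tm Γ 𝟘 → Tm Γ ty2
isZeroAt N = lam (monus one (v0 · wkT N))

constOne : Tm Γ ty2
constOne = lam one

isZeroAt-standard : Der Γ Δ (∀' 𝟘 (st ty2 (isZeroAt v0)))
isZeroAt-standard = ∀I (st-majorised ty2 (axiom (ax-st-cl ty2 (lam one))) isZeroAt-≤*-constOne)
  where
  isZeroAt-≤*-constOne : Der (Γ , 𝟘) Δ (maj ty2 (isZeroAt v0) constOne)
  isZeroAt-≤*-constOne = ∀I (∀I (⊃I (∧I
    (≐-trans (≐-by-normalising {b = monus (monus one (v0 · v2)) one} refl) (∀E one-monus-≤₀-one _))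
    (≐-by-normalising refl))))

gap-isZeroAt : Der Γ Δ (∀' 𝟘 (gap (isZeroAt v0) ≐₀ one))
gap-isZeroAt = ∀I (≐-trans (≐-normalise-cong (monus one (monus one (monus one v0))) (∀E monus-self v0) refl)
                           (≐-by-normalising refl))

test-isZeroAt-below :
  Der Γ Δ (∀' 𝟘 (∀' 𝟘 (∀' 𝟘 (monus v2 v1 ≐₀ cS · v0 ⊃ test · isZeroAt v2 · v1 ≐₀ one))))
test-isZeroAt-below = ∀I (∀I (∀I (⊃I
  (≐-trans (≐-normalise-cong (cR 𝟘 · monus one v0 · gap (isZeroAt v3) · zeroStep) (hyp (here refl)) refl)
  (≐-trans (≐-normalise-cong (cR 𝟘 · v0 · gap (isZeroAt v3) · zeroStep) (∀E one-monus-suc v0) refl)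
  (≐-trans (≐-by-normalising refl) (∀E gap-isZeroAt v2)))))))

isZeroAt-solutions-above : Der Γ Δ (∀' 𝟘 (∀' 𝟘 (test · isZeroAt v1 · v0 ≐₀ c0 ⊃ v1 ≤₀ v0)))
isZeroAt-solutions-above = ∀I (∀I (⊃I (∨E (∀E zero-or-suc (monus v1 v0)) (hyp (here refl))
  (∃E (hyp (here refl)) (⊥E (⊃E (axiom (ax-S≢0 c0))
    (≐-trans (≐-sym (⊃E (∀E (∀E (∀E test-isZeroAt-below v2) v1) v0) (hyp (here refl))))
             (hyp (there (there (here refl)))))))))))

selector-exists : Der Γ Δ (∃' (ty2 ⇒ 𝟘) isSelector)
selector-exists = ⊃E (axiom (ax-QFAC (test · v1 · v0 ≐₀ c0) q≐))
  (∀I (⊃E (∀E (axiom ax-MP) (test · v0)) test-not-not-solvable))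

standard-selector-exists : Der Γ Δ (∃st (ty2 ⇒ 𝟘) isSelector)
standard-selector-exists = ⊃E (axiom (ax-PFTP (ty2 ⇒ 𝟘 ∷ []) isSelector (i∀ i≐))) selector-exists

nonstandard : Tm Γ 𝟘 → Fm Γ
nonstandard N = ∀st 𝟘 (¬' (wkT N ≐₀ v0))

nonstandard-exists : Der Γ Δ (∃' 𝟘 (nonstandard v0))
nonstandard-exists = ⊃E (axiom (ax-I 𝟘 𝟘 (¬' (v1 ≐₀ v0)) (i⊃ i≐ i⊥)))
  (∀I (⊃I (∃I (cS · v0) (∀E ≤₀⇒suc≢ v0))))

theorem3p2 : Der ε [] ⊥'
theorem3p2 = ∃E nonstandard-exists (∃E standard-selector-exists contradiction)
  where
  -- N is v1 and Φ is v0.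
  Θ : List (Fm (ε , 𝟘 , (ty2 ⇒ 𝟘)))
  Θ = (st (ty2 ⇒ 𝟘) v0 ∧' isSelector) ∷ nonstandard v1 ∷ []
  Y-standard : Der (ε , 𝟘 , (ty2 ⇒ 𝟘)) Θ (st ty2 (isZeroAt v1))
  Y-standard = ∀E isZeroAt-standard v1
  ΦY-standard : Der (ε , 𝟘 , (ty2 ⇒ 𝟘)) Θ (st 𝟘 (v0 · isZeroAt v1))
  ΦY-standard = st-app (∧E₁ (hyp (here refl))) Y-standard
  N≤ΦY : Der (ε , 𝟘 , (ty2 ⇒ 𝟘)) Θ (v1 ≤₀ (v0 · isZeroAt v1))
  N≤ΦY = ⊃E (∀E (∀E isZeroAt-solutions-above v1) (v0 · isZeroAt v1))
             (∀E (∧E₂ (hyp (here refl))) (isZeroAt v1))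
  contradiction : Der (ε , 𝟘 , (ty2 ⇒ 𝟘)) Θ ⊥'
  contradiction =
    ⊃E (⊃E (∀E (hyp (there (here refl))) v1) (st-majorised 𝟘 ΦY-standard N≤ΦY)) (≐-refl v1)
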